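{- Let $p,q,r$ be distinct primes. Then, after a suitable permutation of $p,q,r$, one of the following four possibilities holds: (1) $\langle p^{ -1}+q^{ -1}\rangle_r^+<\langle p^{ -1}\rangle_r\le\langle q^{ -1}\rangle_r$, $\langle r^{ -1}\rangle_q\le\langle p^{ -1}\rangle_q<\langle p^{ -1}+r^{ -1}\rangle_q^+$, and $\langle q^{ -1}\rangle_p\le\langle r^{ -1}\rangle_p<\langle q^{ -1}+r^{ -1}\rangle_p^+$; (2) $\langle p^{ -1}+q^{ -1}\rangle_r^+<\langle p^{ -1}\rangle_r\le\langle q^{ -1}\rangle_r$, $\langle r^{ -1}\rangle_q\le\langle p^{ -1}\rangle_q<\langle p^{ -1}+r^{ -1}\rangle_q^+$, and $\langle r^{ -1}\rangle_p\le\langle q^{ -1}\rangle_p<\langle q^{ -1}+r^{ -1}\rangle_p^+$; (3) $\langle p^{ -1}+q^{ -1}\rangle_r^+>\langle p^{ -1}\rangle_r\ge\langle q^{ -1}\rangle_r$, $\langle r^{ -1}\rangle_q\ge\langle p^{ -1}\rangle_q>\langle p^{ -1}+r^{ -1}\rangle_q^+$, and $\langle q^{ -1}\rangle_p\ge\langle r^{ -1}\rangle_p>\langle q^{ -1}+r^{ -1}\rangle_p^+$; (4) $\langle p^{ -1}+q^{ -1}\rangle_r^+>\langle p^{ -1}\rangle_r\ge\langle q^{ -1}\rangle_r$, $\langle r^{ -1}\rangle_q\ge\langle p^{ -1}\rangle_q>\langle p^{ -1}+r^{ -1}\rangle_q^+$, and $\langle r^{ -1}\rangle_p\ge\langle q^{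 -1}\rangle_p>\langle q^{ -1}+r^{ -1}\rangle_p^+$.
   Context: For a rational $c=a/b$ with $b$ coprime to $m$, $\langle c\rangle_m$ is the smallest nonnegative integer $k$ with $kb\equiv a\pmod m$. Moreover $\langle c\rangle_m^+=\langle c\rangle_m$ if $\langle c\rangle_m\ne0$, and $\langle c\rangle_m^+=m$ if $\langle c\rangle_m=0$. -}

module Defs where

open import Data.Nat using (ℕ; zero; suc; _+_; _*_; _%_; _≡ᵇ_; _<ᵇ_; _<_; _≤_)
open import Data.Bool using (Bool; true; false; if_then_else_)
open import Data.Product using (_×_)
open import Data.Sum using (_⊎_)

-- least k < n with P k = true; returns n if there is none
search : (ℕ → Bool) → ℕ → ℕ
search P zero = zero
search P (suc n) with search P n <ᵇ n
... | true  = search P n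
... | false = if P n then n else suc n

-- ⟨ a / b ⟩ m : the smallest nonnegative integer k with k*b ≡ a (mod m)
-- (for b coprime to m such a k exists and lies in [0, m)).
-- For m = 0 the notion is not used; we return 0.
⟨_/_⟩_ : ℕ → ℕ → ℕ → ℕ
⟨ a / b ⟩ zero = zero
⟨ a / b ⟩ (suc m) = search (λ k → ((k * b) % suc m) ≡ᵇ (a % suc m)) (suc m)

⟨_/_⟩⁺_ : ℕ → ℕ → ℕ → ℕ
⟨ a / b ⟩⁺ m with ⟨ a / b ⟩ m
... | zero  = m
... | suc k = suc k

data IsPerm3 (p q r : ℕ) : ℕ → ℕ → ℕ → Set where
  pqr : IsPerm3 p q r p q r
  prq : IsPerm3 p q r p r q
  qpr : IsPerm3 p q r q p r
  qrp : IsPerm3 p q r q r p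
  rpq : IsPerm3 p q r r p q
  rqp : IsPerm3 p q r r q p

-- The four cases, written for the (permuted) triple p q r.
-- p⁻¹ = 1/p, and p⁻¹ + q⁻¹ = (p+q)/(pq).
Case1 : ℕ → ℕ → ℕ → Set
Case1 p q r =
  (⟨ p + q / p * q ⟩⁺ r < ⟨ 1 / p ⟩ r × ⟨ 1 / p ⟩ r ≤ ⟨ 1 / q ⟩ r)
  × (⟨ 1 / r ⟩ q ≤ ⟨ 1 / p ⟩ q × ⟨ 1 / p ⟩ q < ⟨ p + r / p * r ⟩⁺ q)
  × (⟨ 1 / q ⟩ p ≤ ⟨ 1 / r ⟩ p × ⟨ 1 / r ⟩ p < ⟨ q + r / q * r ⟩⁺ p)

Case2 : ℕ → ℕ → ℕ → Set
Case2 p q r =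
  (⟨ p + q / p * q ⟩⁺ r < ⟨ 1 / p ⟩ r × ⟨ 1 / p ⟩ r ≤ ⟨ 1 / q ⟩ r)
  × (⟨ 1 / r ⟩ q ≤ ⟨ 1 / p ⟩ q × ⟨ 1 / p ⟩ q < ⟨ p + r / p * r ⟩⁺ q)
  × (⟨ 1 / r ⟩ p ≤ ⟨ 1 / q ⟩ p × ⟨ 1 / q ⟩ p < ⟨ q + r / q * r ⟩⁺ p)

Case3 : ℕ → ℕ → ℕ → Set
Case3 p q r =
  (⟨ 1 / p ⟩ r < ⟨ p + q / p * q ⟩⁺ r × ⟨ 1 / q ⟩ r ≤ ⟨ 1 / p ⟩ r)
  × (⟨ 1 / p ⟩ q ≤ ⟨ 1 / r ⟩ q × ⟨ p + r / p * r ⟩⁺ q < ⟨ 1 / p ⟩ q)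
  × (⟨ 1 / r ⟩ p ≤ ⟨ 1 / q ⟩ p × ⟨ q + r / q * r ⟩⁺ p < ⟨ 1 / r ⟩ p)

Case4 : ℕ → ℕ → ℕ → Set
Case4 p q r =
  (⟨ 1 / p ⟩ r < ⟨ p + q / p * q ⟩⁺ r × ⟨ 1 / q ⟩ r ≤ ⟨ 1 / p ⟩ r)
  × (⟨ 1 / p ⟩ q ≤ ⟨ 1 / r ⟩ q × ⟨ p + r / p * r ⟩⁺ q < ⟨ 1 / p ⟩ q)
  × (⟨ 1 / q ⟩ p ≤ ⟨ 1 / r ⟩ p × ⟨ q + r / q * r ⟩⁺ p < ⟨ 1 / q ⟩ p)

{-# OPTIONS --safe #-}
module Submission where

-- Write ⟨s⁻¹⟩_t for ⟨ 1 / s ⟩ t. Distinct primes satisfy the reciprocity law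
-- s ⟨s⁻¹⟩_t + t ⟨t⁻¹⟩_s = 1 + s t, and ⟨(s + s')/(s s')⟩⁺_t equals the sum
-- ⟨s⁻¹⟩_t + ⟨s'⁻¹⟩_t, minus t when that sum exceeds t. Weighting the three sums
-- (at the moduli r, q, p) by p q, p r, q r gives p + q + r + 3 p q r, so some but
-- not all of them exceed their modulus. Let r be the modulus that behaves
-- differently from the other two and order p, q by their inverses modulo r. Then
-- a further consequence of reciprocity (balance) fixes the comparison between
-- ⟨r⁻¹⟩_q and ⟨p⁻¹⟩_q, while the two inverses modulo p may compare either way;
-- this gives the four cases.

open import Data.Bool using (Bool; true; false; T)
open import Data.Empty using (⊥; ⊥-elim)
open import Data.Nat
open import Data.Nat.Properties
open import Data.Nat.DivMod
open import Data.Nat.Divisibility using (_∣_; divides; ∣⇒≤; ∣1⇒≡1)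
open import Data.Nat.Primality using (Prime; euclidsLemma; prime⇒irreducible; prime⇒nonZero; prime⇒nonTrivial; ¬prime[1])
open import Data.Nat.Coprimality using (Coprime; coprime-Bézout)
open import Data.Nat.GCD using (module Bézout)
open import Data.Nat.Tactic.RingSolver using (solve-∀)
open import Data.Product using (Σ-syntax; ∃-syntax; _×_; _,_; proj₁; proj₂)
open import Data.Sum using (_⊎_; inj₁; inj₂; map₂)
open import Relation.Binary.PropositionalEquality
open import Relation.Nullary using (¬_)
open import Defs

open ≤-Reasoning

search-sound : ∀ P n → search P n < n → T (P (search P n))
search-sound P (suc n) found with search P n <ᵇ n in lt
... | true = search-sound P n (<ᵇ⇒< _ _ (subst T (sym lt) _))
... | false with P n in Pn
...   | true  = subst T (sym Pn) _
...   | false = ⊥-elim (<-irrefl refl found)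

search-complete : ∀ P n k → k < n → T (P k) → search P n < n
search-complete P (suc n) k k<1+n Pk with search P n <ᵇ n in lt
... | true = m<n⇒m<1+n (<ᵇ⇒< _ _ (subst T (sym lt) _))
... | false with P n in Pn
...   | true  = n<1+n n
...   | false with m<1+n⇒m<n∨m≡n k<1+n
...     | inj₁ k<n  = ⊥-elim (subst T lt (<⇒<ᵇ (search-complete P n k k<n Pk)))
...     | inj₂ refl = ⊥-elim (subst T Pn Pk)

%-≡⇒∣∸ : ∀ m n t .{{_ : NonZero t}} → m % t ≡ n % t → t ∣ n ∸ m
%-≡⇒∣∸ m n t eq = divides (n / t ∸ m / t) (begin-equality
    n ∸ m                                      ≡⟨ cong₂ _∸_ (m≡m%n+[m/n]*n n t) (m≡m%n+[m/n]*n m t) ⟩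
    (n % t + n / t * t) ∸ (m % t + m / t * t)  ≡⟨ cong (λ x → (n % t + n / t * t) ∸ (x + m / t * t)) eq ⟩
    (n % t + n / t * t) ∸ (n % t + m / t * t)  ≡⟨ [m+n]∸[m+o]≡n∸o (n % t) _ _ ⟩
    n / t * t ∸ m / t * t                      ≡⟨ *-distribʳ-∸ t (n / t) (m / t) ⟨
    (n / t ∸ m / t) * t                        ∎)

∣∧<⇒≡0 : ∀ {t n} → t ∣ n → n < t → n ≡ 0
∣∧<⇒≡0 {n = zero}  _   _   = refl
∣∧<⇒≡0 {n = suc _} t∣n n<t = ⊥-elim (<⇒≱ n<t (∣⇒≤ t∣n))

*-cancelʳ-%-prime : ∀ {t b x y} .{{_ : NonZero t}} → Prime t → ¬ t ∣ b → x < t → y < t →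
                    (x * b) % t ≡ (y * b) % t → x ≡ y
*-cancelʳ-%-prime {t} {b} pt t∤b x<t y<t eq = ≤-antisym (≤-from (sym eq) x<t) (≤-from eq y<t)
  where
    ≤-from : ∀ {u v} → (v * b) % t ≡ (u * b) % t → u < t → u ≤ v
    ≤-from {u} {v} eq u<t
      with euclidsLemma (u ∸ v) b pt (subst (t ∣_) (sym (*-distribʳ-∸ b u v)) (%-≡⇒∣∸ (v * b) (u * b) t eq))
    ... | inj₁ t∣u∸v = m∸n≡0⇒m≤n (∣∧<⇒≡0 t∣u∸v (≤-<-trans (m∸n≤m u v) u<t))
    ... | inj₂ t∣b   = ⊥-elim (t∤b t∣b)

⟨/⟩-unique : ∀ {a b t k} .{{_ : NonZero t}} → Prime t → ¬ t ∣ b → k < t → (k * b) % t ≡ a % t → ⟨ a / b ⟩ t ≡ k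
⟨/⟩-unique {t = zero} _ _ () _
⟨/⟩-unique {a} {b} {suc m} {k} pt t∤b k<t kb≡a =
  *-cancelʳ-%-prime pt t∤b found k<t (trans (≡ᵇ⇒≡ _ _ (search-sound P (suc m) found)) (sym kb≡a))
  where
    P : ℕ → Bool
    P x = (x * b) % suc m ≡ᵇ a % suc m
    found : search P (suc m) < suc m
    found = search-complete P (suc m) k k<t (≡⇒≡ᵇ _ _ kb≡a)

[m%n*o]%n≡[m*o]%n : ∀ m o n .{{_ : NonZero n}} → (m % n * o) % n ≡ (m * o) % n
[m%n*o]%n≡[m*o]%n m o n = begin-equality
  (m % n * o) % n              ≡⟨ %-distribˡ-* (m % n) o n ⟩
  (m % n % n * (o % n)) % n    ≡⟨ cong (λ h → (h * (o % n)) % n) (m%n%n≡m%n m n) ⟩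
  (m % n * (o % n)) % n        ≡⟨ %-distribˡ-* m o n ⟨
  (m * o) % n                  ∎

prime>1 : ∀ {p} → Prime p → 1 < p
prime>1 {p} pp = nonTrivial⇒n>1 p {{prime⇒nonTrivial pp}}

distinct-primes-∤ : ∀ {s t} → Prime s → Prime t → s ≢ t → ¬ t ∣ s
distinct-primes-∤ ps pt s≢t t∣s with prime⇒irreducible ps t∣s
... | inj₁ refl = ¬prime[1] pt
... | inj₂ refl = s≢t refl

distinct-primes-coprime : ∀ {s t} → Prime s → Prime t → s ≢ t → Coprime s t
distinct-primes-coprime ps pt s≢t (d∣s , d∣t) with prime⇒irreducible pt d∣t
... | inj₁ d≡1 = d≡1
... | inj₂ refl = ⊥-elim (distinct-primes-∤ ps pt s≢t d∣s)

inverse-exists : ∀ {s t} .{{_ : NonZero t}} → Prime s → Prime t → s ≢ t → ∃[ x ] (x * s) % t ≡ 1 % t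
inverse-exists {s} {t@(suc t-1)} ps pt s≢t with coprime-Bézout (distinct-primes-coprime ps pt s≢t)
... | Bézout.+- x y eq = x , (begin-equality
  (x * s) % t      ≡⟨ cong (_% t) eq ⟨
  (1 + y * t) % t  ≡⟨ [m+kn]%n≡m%n 1 y t ⟩
  1 % t            ∎)
-- Here x s ≡ -1 (mod t), so (t - 1) x is an inverse of s.
... | Bézout.-+ x y eq = t-1 * x , (begin-equality
  (t-1 * x * s) % t                ≡⟨ [m+kn]%n≡m%n (t-1 * x * s) y t ⟨
  (t-1 * x * s + y * t) % t        ≡⟨ cong (λ z → (t-1 * x * s + z) % t) eq ⟨
  (t-1 * x * s + (1 + x * s)) % t  ≡⟨ cong (_% t) (regroup t-1 x s) ⟩
  (1 + x * s * t) % t              ≡⟨ [m+kn]%n≡m%n 1 (x * s) t ⟩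
  1 % t                            ∎)
  where
    regroup : ∀ t-1 x s → t-1 * x * s + (1 + x * s) ≡ 1 + x * s * suc t-1
    regroup = solve-∀

module _ {s t : ℕ} (ps : Prime s) (pt : Prime t) (s≢t : s ≢ t) where
  private instance
    t≢0 : NonZero t
    t≢0 = prime⇒nonZero pt

  private
    inverse-spec : ⟨ 1 / s ⟩ t < t × (⟨ 1 / s ⟩ t * s) % t ≡ 1 % t
    inverse-spec with inverse-exists ps pt s≢t
    ... | x , xs≡1 = subst (λ k → k < t × (k * s) % t ≡ 1 % t) (sym inverse≡x%t) (m%n<n x t , x%t-inverts)
      where
        x%t-inverts : (x % t * s) % t ≡ 1 % t
        x%t-inverts = trans ([m%n*o]%n≡[m*o]%n x s t) xs≡1
        inverse≡x%t : ⟨ 1 / s ⟩ t ≡ x % t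
        inverse≡x%t = ⟨/⟩-unique pt (distinct-primes-∤ ps pt s≢t) (m%n<n x t) x%t-inverts

  inverse<modulus : ⟨ 1 / s ⟩ t < t
  inverse<modulus = proj₁ inverse-spec

  inverse-inverts : (⟨ 1 / s ⟩ t * s) % t ≡ 1
  inverse-inverts = trans (proj₂ inverse-spec) (m<n⇒m%n≡m (prime>1 pt))

  inverse>0 : 0 < ⟨ 1 / s ⟩ t
  inverse>0 = n≢0⇒n>0 λ inverse≡0 →
    0≢1+n (trans (sym (m*n%n≡0 0 t)) (subst (λ k → (k * s) % t ≡ 1) inverse≡0 inverse-inverts))

  -- ⟨t⁻¹⟩_s is read off from k s = 1 + j t, where k = ⟨s⁻¹⟩_t: it is s - j.
  reciprocity : s * ⟨ 1 / s ⟩ t + t * ⟨ 1 / t ⟩ s ≡ 1 + s * t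
  reciprocity = begin-equality
      s * k + t * ⟨ 1 / t ⟩ s  ≡⟨ cong (λ y → s * k + t * y) inverse-of-t ⟩
      s * k + t * (s ∸ j)      ≡⟨ trans (+-comm (s * k) _) (cong₂ _+_ (*-comm t (s ∸ j)) (*-comm s k)) ⟩
      (s ∸ j) * t + k * s      ≡⟨ complement ⟩
      1 + s * t                ∎
    where
      instance
        s≢0 : NonZero s
        s≢0 = prime⇒nonZero ps
      k = ⟨ 1 / s ⟩ t
      j = k * s / t
      ks≡1+jt : k * s ≡ 1 + j * t
      ks≡1+jt = trans (m≡m%n+[m/n]*n (k * s) t) (cong (_+ j * t) inverse-inverts)
      j<s : j < s
      j<s = *-cancelʳ-< t j s (begin-strict
        j * t      <⟨ n<1+n (j * t) ⟩
        1 + j * t  ≡⟨ ks≡1+jt ⟨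
        k * s      <⟨ *-monoˡ-< s inverse<modulus ⟩
        t * s      ≡⟨ *-comm t s ⟩
        s * t      ∎)
      0<j : 0 < j
      0<j = n≢0⇒n>0 λ j≡0 →
        ¬prime[1] (subst Prime (∣1⇒≡1 (divides k (sym (trans ks≡1+jt (cong (λ i → 1 + i * t) j≡0))))) ps)
      complement : (s ∸ j) * t + k * s ≡ 1 + s * t
      complement = begin-equality
        (s ∸ j) * t + k * s          ≡⟨ cong ((s ∸ j) * t +_) ks≡1+jt ⟩
        (s ∸ j) * t + (1 + j * t)    ≡⟨ +-suc ((s ∸ j) * t) (j * t) ⟩
        1 + ((s ∸ j) * t + j * t)    ≡⟨ cong suc (*-distribʳ-+ t (s ∸ j) j) ⟨
        1 + (s ∸ j + j) * t          ≡⟨ cong (λ x → 1 + x * t) (m∸n+n≡m (<⇒≤ j<s)) ⟩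
        1 + s * t                    ∎
      inverse-of-t : ⟨ 1 / t ⟩ s ≡ s ∸ j
      inverse-of-t = ⟨/⟩-unique ps (distinct-primes-∤ pt ps (≢-sym s≢t)) (∸-monoʳ-< 0<j (<⇒≤ j<s)) (begin-equality
        ((s ∸ j) * t) % s          ≡⟨ [m+kn]%n≡m%n _ k s ⟨
        ((s ∸ j) * t + k * s) % s  ≡⟨ cong (_% s) complement ⟩
        (1 + s * t) % s            ≡⟨ cong (λ x → (1 + x) % s) (*-comm s t) ⟩
        (1 + t * s) % s            ≡⟨ [m+kn]%n≡m%n 1 t s ⟩
        1 % s                      ∎)

inverseSum : ℕ → ℕ → ℕ → ℕ
inverseSum t u v = ⟨ 1 / u ⟩ t + ⟨ 1 / v ⟩ t

inverseSum-comm : ∀ t u v → inverseSum t u v ≡ inverseSum t v u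
inverseSum-comm t u v = +-comm (⟨ 1 / u ⟩ t) (⟨ 1 / v ⟩ t)

⟨/⟩⁺-positive : ∀ {a b t k} → ⟨ a / b ⟩ t ≡ k → 0 < k → ⟨ a / b ⟩⁺ t ≡ k
⟨/⟩⁺-positive {k = suc _} eq _ rewrite eq = refl

⟨/⟩⁺-zero : ∀ {a b t} → ⟨ a / b ⟩ t ≡ 0 → ⟨ a / b ⟩⁺ t ≡ t
⟨/⟩⁺-zero eq rewrite eq = refl

⟨/⟩⁺-noOverflow : ∀ {a b t u} .{{_ : NonZero t}} → ⟨ a / b ⟩ t ≡ u % t → 0 < u → u ≤ t →
                  ⟨ a / b ⟩⁺ t ≡ u
⟨/⟩⁺-noOverflow {a} {b} {t} {u} eq 0<u u≤t with m≤n⇒m<n∨m≡n u≤t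
... | inj₁ u<t  = ⟨/⟩⁺-positive {a} {b} {t} (trans eq (m<n⇒m%n≡m u<t)) 0<u
... | inj₂ refl = ⟨/⟩⁺-zero {a} {b} (trans eq (n%n≡0 u))

⟨/⟩⁺-overflow : ∀ {a b t u} .{{_ : NonZero t}} → ⟨ a / b ⟩ t ≡ u % t → t < u → u < t + t →
                ⟨ a / b ⟩⁺ t + t ≡ u
⟨/⟩⁺-overflow {a} {b} {t} {u} eq t<u u<2t = begin-equality
    ⟨ a / b ⟩⁺ t + t  ≡⟨ cong (_+ t) (⟨/⟩⁺-positive {a} {b} {t} (trans eq u%t≡u∸t) (m<n⇒0<n∸m t<u)) ⟩
    u ∸ t + t         ≡⟨ m∸n+n≡m (<⇒≤ t<u) ⟩
    u                 ∎
  where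
    u%t≡u∸t : u % t ≡ u ∸ t
    u%t≡u∸t = trans (sym (m≤n⇒[n∸m]%m≡n%m (<⇒≤ t<u))) (m<n⇒m%n≡m (m<n+o⇒m∸n<o u t u<2t))

[m*n]%o≡1⇒[m*n*k]%o≡k%o : ∀ m n k {o} .{{_ : NonZero o}} → (m * n) % o ≡ 1 → (m * n * k) % o ≡ k % o
[m*n]%o≡1⇒[m*n*k]%o≡k%o m n k {o} eq = begin-equality
  (m * n * k) % o                ≡⟨ %-distribˡ-* (m * n) k o ⟩
  ((m * n) % o * (k % o)) % o    ≡⟨ cong (λ h → (h * (k % o)) % o) eq ⟩
  (1 * (k % o)) % o              ≡⟨ cong (_% o) (*-identityˡ (k % o)) ⟩
  k % o % o                      ≡⟨ m%n%n≡m%n k o ⟩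
  k % o                          ∎

module _ {s s' t : ℕ} (ps : Prime s) (ps' : Prime s') (pt : Prime t) (s≢t : s ≢ t) (s'≢t : s' ≢ t) where
  private instance
    t≢0 : NonZero t
    t≢0 = prime⇒nonZero pt

  ⟨+⟩≡inverseSum%t : ⟨ s + s' / s * s' ⟩ t ≡ inverseSum t s s' % t
  ⟨+⟩≡inverseSum%t = ⟨/⟩-unique pt t∤ss' (m%n<n u t) (begin-equality
      (u % t * (s * s')) % t                      ≡⟨ [m%n*o]%n≡[m*o]%n u (s * s') t ⟩
      (u * (s * s')) % t                          ≡⟨ cong (_% t) (expand x x' s s') ⟩
      (x * s * s' + x' * s' * s) % t              ≡⟨ %-distribˡ-+ (x * s * s') (x' * s' * s) t ⟩
      ((x * s * s') % t + (x' * s' * s) % t) % t  ≡⟨ cong₂ (λ a b → (a + b) % t)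
                                                       ([m*n]%o≡1⇒[m*n*k]%o≡k%o x s s' (inverse-inverts ps pt s≢t))
                                                       ([m*n]%o≡1⇒[m*n*k]%o≡k%o x' s' s (inverse-inverts ps' pt s'≢t)) ⟩
      (s' % t + s % t) % t                        ≡⟨ %-distribˡ-+ s' s t ⟨
      (s' + s) % t                                ≡⟨ cong (_% t) (+-comm s' s) ⟩
      (s + s') % t                                ∎)
    where
      x = ⟨ 1 / s ⟩ t
      x' = ⟨ 1 / s' ⟩ t
      u = inverseSum t s s'
      t∤ss' : ¬ t ∣ s * s'
      t∤ss' t∣ss' with euclidsLemma s s' pt t∣ss'
      ... | inj₁ t∣s  = distinct-primes-∤ ps pt s≢t t∣s
      ... | inj₂ t∣s' = distinct-primes-∤ ps' pt s'≢t t∣s'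
      expand : ∀ x x' s s' → (x + x') * (s * s') ≡ x * s * s' + x' * s' * s
      expand = solve-∀

  ⟨+⟩⁺-noOverflow : inverseSum t s s' ≤ t → ⟨ s + s' / s * s' ⟩⁺ t ≡ inverseSum t s s'
  ⟨+⟩⁺-noOverflow = ⟨/⟩⁺-noOverflow ⟨+⟩≡inverseSum%t (≤-trans (inverse>0 ps pt s≢t) (m≤m+n _ _))

  ⟨+⟩⁺-overflow : t < inverseSum t s s' → ⟨ s + s' / s * s' ⟩⁺ t + t ≡ inverseSum t s s'
  ⟨+⟩⁺-overflow t<u =
    ⟨/⟩⁺-overflow ⟨+⟩≡inverseSum%t t<u (+-mono-< (inverse<modulus ps pt s≢t) (inverse<modulus ps' pt s'≢t))

m*x+c≤m*y+d⇒x≤y : ∀ m {x y c d} → m * x + c ≤ m * y + d → d < m + c → x ≤ y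
m*x+c≤m*y+d⇒x≤y m {x} {y} {c} {d} le d<m+c =
  s≤s⁻¹ (*-cancelˡ-< m x (suc y) (+-cancelʳ-< c (m * x) (m * suc y) (begin-strict
    m * x + c        ≤⟨ le ⟩
    m * y + d        <⟨ +-monoʳ-< (m * y) d<m+c ⟩
    m * y + (m + c)  ≡⟨ +-assoc (m * y) m c ⟨
    m * y + m + c    ≡⟨ cong (_+ c) (trans (+-comm (m * y) m) (sym (*-suc m y))) ⟩
    m * suc y + c    ∎)))

m+n≡o+k∧k<n⇒m<o : ∀ {m n o k} → m + n ≡ o + k → k < n → m < o
m+n≡o+k∧k<n⇒m<o {m} {n} {o} {k} eq k<n = +-cancelʳ-< n m o (begin-strict
  m + n  ≡⟨ eq ⟩
  o + k  <⟨ +-monoʳ-< o k<n ⟩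
  o + n  ∎)

module _ {p q r : ℕ} (prime-p : Prime p) (prime-q : Prime q) (prime-r : Prime r)
         (p≢q : p ≢ q) (q≢r : q ≢ r) (p≢r : p ≢ r) where
  private
    instance
      p≢0 : NonZero p
      p≢0 = prime⇒nonZero prime-p
      q≢0 : NonZero q
      q≢0 = prime⇒nonZero prime-q
      r≢0 : NonZero r
      r≢0 = prime⇒nonZero prime-r

    p⁻¹[q] = ⟨ 1 / p ⟩ q
    p⁻¹[r] = ⟨ 1 / p ⟩ r
    q⁻¹[p] = ⟨ 1 / q ⟩ p
    q⁻¹[r] = ⟨ 1 / q ⟩ r
    r⁻¹[p] = ⟨ 1 / r ⟩ p
    r⁻¹[q] = ⟨ 1 / r ⟩ q

  inverseSums-weighted :
    p * q * inverseSum r p q + p * r * inverseSum q p r + q * r * inverseSum p q r ≡ p + q + r + 3 * (p * q * r)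
  inverseSums-weighted = begin-equality
      p * q * (p⁻¹[r] + q⁻¹[r]) + p * r * (p⁻¹[q] + r⁻¹[q]) + q * r * (q⁻¹[p] + r⁻¹[p])
    ≡⟨ regroup p q r p⁻¹[r] q⁻¹[r] p⁻¹[q] r⁻¹[q] q⁻¹[p] r⁻¹[p] ⟩
      q * (p * p⁻¹[r] + r * r⁻¹[p]) + p * (q * q⁻¹[r] + r * r⁻¹[q]) + r * (p * p⁻¹[q] + q * q⁻¹[p])
    ≡⟨ cong₂ (λ x y → q * x + p * y + r * (p * p⁻¹[q] + q * q⁻¹[p]))
             (reciprocity prime-p prime-r p≢r) (reciprocity prime-q prime-r q≢r) ⟩
      q * (1 + p * r) + p * (1 + q * r) + r * (p * p⁻¹[q] + q * q⁻¹[p])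
    ≡⟨ cong (λ x → q * (1 + p * r) + p * (1 + q * r) + r * x) (reciprocity prime-p prime-q p≢q) ⟩
      q * (1 + p * r) + p * (1 + q * r) + r * (1 + p * q)
    ≡⟨ expand p q r ⟩
      p + q + r + 3 * (p * q * r)
    ∎
    where
      regroup : ∀ p q r a b c d e f →
        p * q * (a + b) + p * r * (c + d) + q * r * (e + f) ≡ q * (p * a + r * f) + p * (q * b + r * d) + r * (p * c + q * e)
      regroup = solve-∀
      expand : ∀ p q r → q * (1 + p * r) + p * (1 + q * r) + r * (1 + p * q) ≡ p + q + r + 3 * (p * q * r)
      expand = solve-∀

  not-all-overflow : r < inverseSum r p q → q < inverseSum q p r → p < inverseSum p q r → ⊥
  not-all-overflow r<σ q<σ p<σ = <-irrefl refl (begin-strict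
      p + q + r + 3 * (p * q * r)
    <⟨ +-monoˡ-< (3 * (p * q * r)) (+-mono-<-≤ (+-mono-<-≤ (m<m*n p q (prime>1 prime-q)) (m≤m*n q r)) (m≤m*n r p)) ⟩
      p * q + q * r + r * p + 3 * (p * q * r)
    ≡⟨ spread p q r ⟩
      p * q * suc r + p * r * suc q + q * r * suc p
    ≤⟨ +-mono-≤ (+-mono-≤ (*-monoʳ-≤ (p * q) r<σ) (*-monoʳ-≤ (p * r) q<σ)) (*-monoʳ-≤ (q * r) p<σ) ⟩
      p * q * inverseSum r p q + p * r * inverseSum q p r + q * r * inverseSum p q r
    ≡⟨ inverseSums-weighted ⟩
      p + q + r + 3 * (p * q * r)
    ∎)
    where
      spread : ∀ p q r → p * q + q * r + r * p + 3 * (p * q * r) ≡ p * q * suc r + p * r * suc q + q * r * suc p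
      spread = solve-∀

  not-none-overflow : inverseSum r p q ≤ r → inverseSum q p r ≤ q → inverseSum p q r ≤ p → ⊥
  not-none-overflow σ≤r σ≤q σ≤p = <-irrefl refl (begin-strict
      3 * (p * q * r)
    <⟨ m<n+m (3 * (p * q * r)) (≤-trans (<⇒≤ (prime>1 prime-p)) (≤-trans (m≤m+n p q) (m≤m+n (p + q) r))) ⟩
      p + q + r + 3 * (p * q * r)
    ≡⟨ inverseSums-weighted ⟨
      p * q * inverseSum r p q + p * r * inverseSum q p r + q * r * inverseSum p q r
    ≤⟨ +-mono-≤ (+-mono-≤ (*-monoʳ-≤ (p * q) σ≤r) (*-monoʳ-≤ (p * r) σ≤q)) (*-monoʳ-≤ (q * r) σ≤p) ⟩
      p * q * r + p * r * q + q * r * p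
    ≡⟨ collect p q r ⟩
      3 * (p * q * r)
    ∎)
    where
      collect : ∀ p q r → p * q * r + p * r * q + q * r * p ≡ 3 * (p * q * r)
      collect = solve-∀

  balance : p * r * ⟨ 1 / r ⟩ q + (q + r) + (p * q * ⟨ 1 / q ⟩ r + q * r * p)
          ≡ p * r * ⟨ 1 / p ⟩ q + p + (p * q * ⟨ 1 / p ⟩ r + q * r * inverseSum p q r)
  balance = begin-equality
      p * r * r⁻¹[q] + (q + r) + (p * q * q⁻¹[r] + q * r * p)
    ≡⟨ regroupˡ p q r q⁻¹[r] r⁻¹[q] ⟩
      p * (q * q⁻¹[r] + r * r⁻¹[q]) + (q + r + q * r * p)
    ≡⟨ cong (λ x → p * x + (q + r + q * r * p)) (reciprocity prime-q prime-r q≢r) ⟩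
      p * (1 + q * r) + (q + r + q * r * p)
    ≡⟨ expand p q r ⟩
      q * (1 + p * r) + r * (1 + p * q) + p
    ≡⟨ cong₂ (λ x y → q * x + r * y + p) (reciprocity prime-p prime-r p≢r) (reciprocity prime-p prime-q p≢q) ⟨
      q * (p * p⁻¹[r] + r * r⁻¹[p]) + r * (p * p⁻¹[q] + q * q⁻¹[p]) + p
    ≡⟨ regroupʳ p q r p⁻¹[r] r⁻¹[p] p⁻¹[q] q⁻¹[p] ⟩
      p * r * p⁻¹[q] + p + (p * q * p⁻¹[r] + q * r * (q⁻¹[p] + r⁻¹[p]))
    ∎
    where
      regroupˡ : ∀ p q r b d → p * r * d + (q + r) + (p * q * b + q * r * p) ≡ p * (q * b + r * d) + (q + r + q * r * p)
      regroupˡ = solve-∀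
      expand : ∀ p q r → p * (1 + q * r) + (q + r + q * r * p) ≡ q * (1 + p * r) + r * (1 + p * q) + p
      expand = solve-∀
      regroupʳ : ∀ p q r a f c e → q * (p * a + r * f) + r * (p * c + q * e) + p ≡ p * r * c + p + (p * q * a + q * r * (e + f))
      regroupʳ = solve-∀

  oneOverflow-order : ⟨ 1 / p ⟩ r ≤ ⟨ 1 / q ⟩ r → inverseSum p q r ≤ p → ⟨ 1 / r ⟩ q ≤ ⟨ 1 / p ⟩ q
  oneOverflow-order p⁻¹≤q⁻¹ σ≤p = m*x+c≤m*y+d⇒x≤y (p * r) (+-cancelʳ-≤ (p * q * q⁻¹[r] + q * r * p) _ _ (begin
      p * r * r⁻¹[q] + (q + r) + (p * q * q⁻¹[r] + q * r * p)
    ≡⟨ balance ⟩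
      p * r * p⁻¹[q] + p + (p * q * p⁻¹[r] + q * r * inverseSum p q r)
    ≤⟨ +-monoʳ-≤ (p * r * p⁻¹[q] + p) (+-mono-≤ (*-monoʳ-≤ (p * q) p⁻¹≤q⁻¹) (*-monoʳ-≤ (q * r) σ≤p)) ⟩
      p * r * p⁻¹[q] + p + (p * q * q⁻¹[r] + q * r * p)
    ∎))
    (≤-<-trans (m≤m*n p r) (m<m+n (p * r) (≤-trans (<⇒≤ (prime>1 prime-q)) (m≤m+n q r))))

  twoOverflows-order : ⟨ 1 / q ⟩ r ≤ ⟨ 1 / p ⟩ r → p < inverseSum p q r → ⟨ 1 / p ⟩ q ≤ ⟨ 1 / r ⟩ q
  twoOverflows-order q⁻¹≤p⁻¹ p<σ = m*x+c≤m*y+d⇒x≤y (p * r) (+-cancelʳ-≤ (p * q * q⁻¹[r] + q * r * p) _ _ (begin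
      p * r * p⁻¹[q] + (q * r + p) + (p * q * q⁻¹[r] + q * r * p)
    ≡⟨ shift (p * r * p⁻¹[q]) (q * r) p (p * q * q⁻¹[r]) ⟩
      p * r * p⁻¹[q] + p + (p * q * q⁻¹[r] + q * r * suc p)
    ≤⟨ +-monoʳ-≤ (p * r * p⁻¹[q] + p) (+-mono-≤ (*-monoʳ-≤ (p * q) q⁻¹≤p⁻¹) (*-monoʳ-≤ (q * r) p<σ)) ⟩
      p * r * p⁻¹[q] + p + (p * q * p⁻¹[r] + q * r * inverseSum p q r)
    ≡⟨ balance ⟨
      p * r * r⁻¹[q] + (q + r) + (p * q * q⁻¹[r] + q * r * p)
    ∎))
    (subst (_< p * r + (q * r + p)) (+-comm r q)
      (+-mono-≤-< (m≤n*m r p) (≤-<-trans (m≤m*n q r) (m<m+n (q * r) (<⇒≤ (prime>1 prime-p))))))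
    where
      shift : ∀ x qr p b → x + (qr + p) + (b + qr * p) ≡ x + p + (b + qr * suc p)
      shift = solve-∀

  oneOverflow : r < inverseSum r p q → inverseSum q p r ≤ q → inverseSum p q r ≤ p →
                ⟨ 1 / p ⟩ r ≤ ⟨ 1 / q ⟩ r → Case1 p q r ⊎ Case2 p q r
  oneOverflow r<σ σ≤q σ≤p p⁻¹≤q⁻¹ = at-p (≤-total q⁻¹[p] r⁻¹[p])
    where
      at-r : ⟨ p + q / p * q ⟩⁺ r < p⁻¹[r] × p⁻¹[r] ≤ q⁻¹[r]
      at-r = m+n≡o+k∧k<n⇒m<o (⟨+⟩⁺-overflow prime-p prime-q prime-r p≢r q≢r r<σ) (inverse<modulus prime-q prime-r q≢r)
           , p⁻¹≤q⁻¹
      at-q : r⁻¹[q] ≤ p⁻¹[q] × p⁻¹[q] < ⟨ p + r / p * r ⟩⁺ q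
      at-q = oneOverflow-order p⁻¹≤q⁻¹ σ≤p
           , subst (p⁻¹[q] <_) (sym (⟨+⟩⁺-noOverflow prime-p prime-r prime-q p≢q (≢-sym q≢r) σ≤q))
                   (m<m+n p⁻¹[q] (inverse>0 prime-r prime-q (≢-sym q≢r)))
      ⁺-at-p : ⟨ q + r / q * r ⟩⁺ p ≡ inverseSum p q r
      ⁺-at-p = ⟨+⟩⁺-noOverflow prime-q prime-r prime-p (≢-sym p≢q) (≢-sym p≢r) σ≤p
      at-p : q⁻¹[p] ≤ r⁻¹[p] ⊎ r⁻¹[p] ≤ q⁻¹[p] → Case1 p q r ⊎ Case2 p q r
      at-p (inj₁ q⁻¹≤r⁻¹) = inj₁ (at-r , at-q , q⁻¹≤r⁻¹
        , subst (r⁻¹[p] <_) (sym ⁺-at-p) (m<n+m r⁻¹[p] (inverse>0 prime-q prime-p (≢-sym p≢q))))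
      at-p (inj₂ r⁻¹≤q⁻¹) = inj₂ (at-r , at-q , r⁻¹≤q⁻¹
        , subst (q⁻¹[p] <_) (sym ⁺-at-p) (m<m+n q⁻¹[p] (inverse>0 prime-r prime-p (≢-sym p≢r))))

  twoOverflows : inverseSum r p q ≤ r → q < inverseSum q p r → p < inverseSum p q r →
                 ⟨ 1 / q ⟩ r ≤ ⟨ 1 / p ⟩ r → Case3 p q r ⊎ Case4 p q r
  twoOverflows σ≤r q<σ p<σ q⁻¹≤p⁻¹ = at-p (≤-total r⁻¹[p] q⁻¹[p])
    where
      at-r : p⁻¹[r] < ⟨ p + q / p * q ⟩⁺ r × q⁻¹[r] ≤ p⁻¹[r]
      at-r = subst (p⁻¹[r] <_) (sym (⟨+⟩⁺-noOverflow prime-p prime-q prime-r p≢r q≢r σ≤r))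
                   (m<m+n p⁻¹[r] (inverse>0 prime-q prime-r q≢r))
           , q⁻¹≤p⁻¹
      at-q : p⁻¹[q] ≤ r⁻¹[q] × ⟨ p + r / p * r ⟩⁺ q < p⁻¹[q]
      at-q = twoOverflows-order q⁻¹≤p⁻¹ p<σ
           , m+n≡o+k∧k<n⇒m<o (⟨+⟩⁺-overflow prime-p prime-r prime-q p≢q (≢-sym q≢r) q<σ)
                                (inverse<modulus prime-r prime-q (≢-sym q≢r))
      ⁺-at-p : ⟨ q + r / q * r ⟩⁺ p + p ≡ inverseSum p q r
      ⁺-at-p = ⟨+⟩⁺-overflow prime-q prime-r prime-p (≢-sym p≢q) (≢-sym p≢r) p<σ
      at-p : r⁻¹[p] ≤ q⁻¹[p] ⊎ q⁻¹[p] ≤ r⁻¹[p] → Case3 p q r ⊎ Case4 p q r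
      at-p (inj₁ r⁻¹≤q⁻¹) = inj₁ (at-r , at-q , r⁻¹≤q⁻¹
        , m+n≡o+k∧k<n⇒m<o (trans ⁺-at-p (+-comm q⁻¹[p] r⁻¹[p])) (inverse<modulus prime-q prime-p (≢-sym p≢q)))
      at-p (inj₂ q⁻¹≤r⁻¹) = inj₂ (at-r , at-q , q⁻¹≤r⁻¹
        , m+n≡o+k∧k<n⇒m<o ⁺-at-p (inverse<modulus prime-r prime-p (≢-sym p≢r)))

Cases : ℕ → ℕ → ℕ → Set
Cases x y z = Case1 x y z ⊎ Case2 x y z ⊎ Case3 x y z ⊎ Case4 x y z

module _ {p q r : ℕ} (prime-p : Prime p) (prime-q : Prime q) (prime-r : Prime r)
         (p≢q : p ≢ q) (q≢r : q ≢ r) (p≢r : p ≢ r) where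

  oneOverflow-sorted : r < inverseSum r p q → inverseSum q p r ≤ q → inverseSum p q r ≤ p →
                       Cases p q r ⊎ Cases q p r
  oneOverflow-sorted r<σ σ≤q σ≤p with ≤-total (⟨ 1 / p ⟩ r) (⟨ 1 / q ⟩ r)
  ... | inj₁ p⁻¹≤q⁻¹ = inj₁ (map₂ inj₁ (oneOverflow prime-p prime-q prime-r p≢q q≢r p≢r r<σ σ≤q σ≤p p⁻¹≤q⁻¹))
  ... | inj₂ q⁻¹≤p⁻¹ = inj₂ (map₂ inj₁ (oneOverflow prime-q prime-p prime-r (≢-sym p≢q) p≢r q≢r
                              (subst (r <_) (inverseSum-comm r p q) r<σ) σ≤p σ≤q q⁻¹≤p⁻¹))

  twoOverflows-sorted : inverseSum r p q ≤ r → q < inverseSum q p r → p < inverseSum p q r →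
                        Cases p q r ⊎ Cases q p r
  twoOverflows-sorted σ≤r q<σ p<σ with ≤-total (⟨ 1 / q ⟩ r) (⟨ 1 / p ⟩ r)
  ... | inj₁ q⁻¹≤p⁻¹ = inj₁ (inj₂ (inj₂ (twoOverflows prime-p prime-q prime-r p≢q q≢r p≢r σ≤r q<σ p<σ q⁻¹≤p⁻¹)))
  ... | inj₂ p⁻¹≤q⁻¹ = inj₂ (inj₂ (inj₂ (twoOverflows prime-q prime-p prime-r (≢-sym p≢q) p≢r q≢r
                              (subst (_≤ r) (inverseSum-comm r p q) σ≤r) p<σ q<σ p⁻¹≤q⁻¹)))

conclude : ∀ {p q r x y z} → IsPerm3 p q r x y z → IsPerm3 p q r y x z → Cases x y z ⊎ Cases y x z →
           Σ[ x′ ∈ ℕ ] Σ[ y′ ∈ ℕ ] Σ[ z′ ∈ ℕ ] (IsPerm3 p q r x′ y′ z′ × Cases x′ y′ z′)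
conclude xyz _   (inj₁ cases) = _ , _ , _ , xyz , cases
conclude _   yxz (inj₂ cases) = _ , _ , _ , yxz , cases

mainTheorem18 : (p q r : ℕ) → Prime p → Prime q → Prime r →
    p ≢ q → q ≢ r → p ≢ r →
    Σ[ x ∈ ℕ ] Σ[ y ∈ ℕ ] Σ[ z ∈ ℕ ] (IsPerm3 p q r x y z ×
    (Case1 x y z ⊎ Case2 x y z ⊎ Case3 x y z ⊎ Case4 x y z))
mainTheorem18 p q r P Q R p≢q q≢r p≢r
  with <-≤-connex p (inverseSum p q r) | <-≤-connex q (inverseSum q p r) | <-≤-connex r (inverseSum r p q)
... | inj₁ p<σ | inj₁ q<σ | inj₁ r<σ =
  ⊥-elim (not-all-overflow P Q R p≢q q≢r p≢r r<σ q<σ p<σ)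
... | inj₂ σ≤p | inj₂ σ≤q | inj₂ σ≤r =
  ⊥-elim (not-none-overflow P Q R p≢q q≢r p≢r σ≤r σ≤q σ≤p)
... | inj₂ σ≤p | inj₂ σ≤q | inj₁ r<σ =
  conclude pqr qpr (oneOverflow-sorted P Q R p≢q q≢r p≢r r<σ σ≤q σ≤p)
... | inj₂ σ≤p | inj₁ q<σ | inj₂ σ≤r =
  conclude prq rpq (oneOverflow-sorted P R Q p≢r (≢-sym q≢r) p≢q q<σ σ≤r
                      (subst (_≤ p) (inverseSum-comm p q r) σ≤p))
... | inj₁ p<σ | inj₂ σ≤q | inj₂ σ≤r =
  conclude qrp rqp (oneOverflow-sorted Q R P q≢r (≢-sym p≢r) (≢-sym p≢q) p<σ
                      (subst (_≤ r) (inverseSum-comm r p q) σ≤r) (subst (_≤ q) (inverseSum-comm q p r) σ≤q))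
... | inj₁ p<σ | inj₁ q<σ | inj₂ σ≤r =
  conclude pqr qpr (twoOverflows-sorted P Q R p≢q q≢r p≢r σ≤r q<σ p<σ)
... | inj₁ p<σ | inj₂ σ≤q | inj₁ r<σ =
  conclude prq rpq (twoOverflows-sorted P R Q p≢r (≢-sym q≢r) p≢q σ≤q r<σ
                      (subst (p <_) (inverseSum-comm p q r) p<σ))
... | inj₂ σ≤p | inj₁ q<σ | inj₁ r<σ =
  conclude qrp rqp (twoOverflows-sorted Q R P q≢r (≢-sym p≢r) (≢-sym p≢q) σ≤p
                      (subst (r <_) (inverseSum-comm r p q) r<σ) (subst (q <_) (inverseSum-comm q p r) q<σ))
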